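{- For every $n\in\mathbb N$, the set $\mathbb P^{T}_n=\{p^{(k)}_n: k\in\mathbb N\}$ is not (R)-dense. Moreover, $$\lim_{k\to+\infty}\frac{p^{(k+1)}_n}{p^{(k)}_n}=+\infty,$$ and every point of $R(\mathbb P^T_n)$ is isolated; more precisely, $R^d(\mathbb P^T_n)\cap(0,+\infty)=\emptyset$.
   Context: Let $p_n$ denote the $n$-th prime number ($p_1=2$). Define $p^{(0)}_n=n$ and recursively $p^{(k+1)}_n=p_{p^{(k)}_n}$ for $k\in\mathbb N_0$. For $A\subset\mathbb N$, its ratio set is $R(A)=\{a/b: a,b\in A\}$, and $A$ is called (R)-dense if $R(A)$ is dense in $(0,+\infty)$. For $B\subset(0,+\infty)$, $B^d$ denotes the set of accumulation points of $B$ in $(0,+\infty)$; $R^d(A)$ means $(R(A))^d$. -}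

module Defs where

open import Data.Nat using (ℕ; zero; suc; _+_; _*_; _≤_; _<_)
open import Data.Nat.Primality using (Prime; prime?)
open import Data.Product using (_×_)
open import Relation.Nullary using (yes; no)
open import Relation.Binary.PropositionalEquality using (_≡_)

primeCount : ℕ → ℕ
primeCount zero = 0
primeCount (suc x) with prime? (suc x)
... | yes _ = suc (primeCount x)
... | no  _ = primeCount x

IsNthPrime : ℕ → ℕ → Set
IsNthPrime n q = Prime q × (primeCount q ≡ n)

-- p : ℕ → ℕ is the prime enumeration n ↦ p_n (for n ≥ 1; the value at 0 is irrelevant).
IsPrimeEnumeration : (ℕ → ℕ) → Set
IsPrimeEnumeration p = ∀ n → 1 ≤ n → IsNthPrime n (p n)

iterate : (ℕ → ℕ) → ℕ → ℕ → ℕ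
iterate p zero    n = n
iterate p (suc k) n = p (iterate p k n)

-- Positive rationals x/y and the ratio a/b (all denominators positive) are compared
-- by cross-multiplication:  x/y < a/b  ⇔  x * b < a * y.

{-# OPTIONS --safe #-}
-- Every prime in (m, 2m] divides the central binomial coefficient, which is at most 4^m;
-- so there are at most 2m / log₂(m + 1) of them, and halving repeatedly gives π(x) = o(x).
-- Since π(p m) = m, this says p m / m → ∞, hence p^(k+1)_n / p^(k)_n → ∞ because
-- p^(k)_n ≥ k.  For a sequence whose consecutive ratios tend to infinity, a bounded
-- ratio f i / f j with i ≠ j forces both indices below a fixed bound, which gives
-- both the finiteness of the ratios in any [α, β] ⊂ (0, ∞) and a gap (1, 1 + 1/D)
-- free of ratios.
module Submission where

open import Defs
open import Data.Nat
open import Data.Nat.Properties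
open import Data.Nat.Divisibility
open import Data.Nat.Primality
open import Data.Nat.Coprimality using (Coprime; coprime⇒gcd≡1)
open import Data.Nat.GCD using (gcd)
open import Data.Nat.LCM using (lcm; lcm-least; gcd*lcm)
open import Data.Nat.Combinatorics using (_C_; nCk≡n!/k![n-k]!; k![n∸k]!∣n!; nCk+nC[k+1]≡[n+1]C[k+1])
open import Data.Nat.DivMod using (m/n*n≡m)
open import Data.Nat.Induction using (<-rec)
open import Data.Nat.Tactic.RingSolver using (solve-∀)
open import Data.Product
open import Data.Sum
open import Relation.Nullary
open import Relation.Binary.Definitions using (tri<; tri≈; tri>)
open import Relation.Binary.PropositionalEquality

prime⇒2≤ : ∀ {q} → Prime q → 2 ≤ q
prime⇒2≤ {q} pq = nonTrivial⇒n>1 q {{prime⇒nonTrivial pq}}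

^-cancelˡ-≤ : ∀ m {a b} → 1 < m → m ^ a ≤ m ^ b → a ≤ b
^-cancelˡ-≤ m 1<m mᵃ≤mᵇ = ≮⇒≥ λ b<a → <⇒≱ (^-monoʳ-< m 1<m b<a) mᵃ≤mᵇ

primeCount-suc≤ : ∀ x → primeCount (suc x) ≤ suc (primeCount x)
primeCount-suc≤ x with prime? (suc x)
... | yes _ = ≤-refl
... | no _  = n≤1+n _

primeCount-≤-suc : ∀ x → primeCount x ≤ primeCount (suc x)
primeCount-≤-suc x with prime? (suc x)
... | yes _ = n≤1+n _
... | no _  = ≤-refl

primeCount-mono-≤ : ∀ {x y} → x ≤ y → primeCount x ≤ primeCount y
primeCount-mono-≤ x≤y = go (≤⇒≤′ x≤y)
  where
  go : ∀ {x y} → x ≤′ y → primeCount x ≤ primeCount y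
  go ≤′-refl                    = ≤-refl
  go {y = suc y} (≤′-step x≤′y) = ≤-trans (go x≤′y) (primeCount-≤-suc y)

primeCount[1+x]≤x : ∀ x → primeCount (suc x) ≤ x
primeCount[1+x]≤x zero    = z≤n
primeCount[1+x]≤x (suc x) = ≤-trans (primeCount-suc≤ (suc x)) (s≤s (primeCount[1+x]≤x x))

primeCount≤ : ∀ x → primeCount x ≤ x
primeCount≤ zero    = z≤n
primeCount≤ (suc x) = m≤n⇒m≤1+n (primeCount[1+x]≤x x)

isNthPrime⇒< : ∀ {m q} → IsNthPrime m q → m < q
isNthPrime⇒< {q = q} (pq , πq≡m) with q | prime⇒2≤ pq
... | suc y | _ = s≤s (subst (_≤ y) πq≡m (primeCount[1+x]≤x y))

∣! : ∀ {q n} → 1 ≤ q → q ≤ n → q ∣ n !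
∣! {suc q} _ q≤n = ∣-trans (m∣m*n (q !)) (m≤n⇒m!∣n! q≤n)

prime∤! : ∀ {q} n → Prime q → n < q → q ∤ n !
prime∤! zero pq _ q∣1 = <⇒≱ (prime⇒2≤ pq) (∣⇒≤ q∣1)
prime∤! (suc n) pq n<q q∣n! with euclidsLemma (suc n) (n !) pq q∣n!
... | inj₁ q∣1+n = <⇒≱ n<q (∣⇒≤ q∣1+n)
... | inj₂ q∣n!′ = prime∤! n pq (<-trans (n<1+n n) n<q) q∣n!′

prime∤⇒coprime : ∀ {q d} → Prime q → q ∤ d → Coprime q d
prime∤⇒coprime pq q∤d {i} (i∣q , i∣d) with prime⇒irreducible pq i∣q
... | inj₁ i≡1 = i≡1
... | inj₂ refl = contradiction i∣d q∤d

coprime-∣⇒*-∣ : ∀ {q d N} → Coprime q d → q ∣ N → d ∣ N → q * d ∣ N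
coprime-∣⇒*-∣ {q} {d} cop q∣N d∣N = subst (_∣ _) lcm≡q*d (lcm-least q∣N d∣N)
  where
  lcm≡q*d : lcm q d ≡ q * d
  lcm≡q*d = begin
    lcm q d            ≡⟨ *-identityˡ (lcm q d) ⟨
    1 * lcm q d        ≡⟨ cong (_* lcm q d) (coprime⇒gcd≡1 cop) ⟨
    gcd q d * lcm q d  ≡⟨ gcd*lcm q d ⟩
    q * d              ∎
    where open ≡-Reasoning

nCk*[k!*[n∸k]!]≡n! : ∀ {n k} → k ≤ n → (n C k) * (k ! * (n ∸ k) !) ≡ n !
nCk*[k!*[n∸k]!]≡n! {n} {k} k≤n = begin
  (n C k) * (k ! * (n ∸ k) !)                  ≡⟨ cong (_* (k ! * (n ∸ k) !)) (nCk≡n!/k![n-k]! k≤n) ⟩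
  n ! / (k ! * (n ∸ k) !) * (k ! * (n ∸ k) !)  ≡⟨ m/n*n≡m (k![n∸k]!∣n! k≤n) ⟩
  n !                                          ∎
  where
  open ≡-Reasoning
  instance _ = k !* (n ∸ k) !≢0

nCk≤2^n : ∀ n k → n C k ≤ 2 ^ n
nCk≤2^n n       zero    = m^n>0 2 n
nCk≤2^n zero    (suc k) = z≤n
nCk≤2^n (suc n) (suc k) = begin
  suc n C suc k          ≡⟨ nCk+nC[k+1]≡[n+1]C[k+1] n k ⟨
  n C k + n C suc k      ≤⟨ +-mono-≤ (nCk≤2^n n k) (nCk≤2^n n (suc k)) ⟩
  2 ^ n + 2 ^ n          ≡⟨ cong (2 ^ n +_) (+-identityʳ (2 ^ n)) ⟨
  2 ^ suc n              ∎
  where open ≤-Reasoning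

centralBinomial*m!m!≡[2m]! : ∀ m → ((m + m) C m) * (m ! * m !) ≡ (m + m) !
centralBinomial*m!m!≡[2m]! m =
  subst (λ r → ((m + m) C m) * (m ! * r !) ≡ (m + m) !) (m+n∸m≡n m m)
        (nCk*[k!*[n∸k]!]≡n! (m≤m+n m m))

centralBinomial≢0 : ∀ m → NonZero ((m + m) C m)
centralBinomial≢0 m with (m + m) C m | centralBinomial*m!m!≡[2m]! m
... | zero  | 0≡[2m]! = contradiction (subst (1 ≤_) (sym 0≡[2m]!) (1≤n! (m + m))) λ ()
... | suc _ | _       = _

prime∣centralBinomial : ∀ {q} m → Prime q → m < q → q ≤ m + m → q ∣ (m + m) C m
prime∣centralBinomial m pq m<q q≤2m
  with euclidsLemma ((m + m) C m) (m ! * m !) pq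
         (subst (_ ∣_) (sym (centralBinomial*m!m!≡[2m]! m)) (∣! (≤-trans (s≤s z≤n) (prime⇒2≤ pq)) q≤2m))
... | inj₁ q∣C = q∣C
... | inj₂ q∣m!m! = contradiction (euclidsLemma (m !) (m !) pq q∣m!m!) [ prime∤! m pq m<q , prime∤! m pq m<q ]′

-- Chebyshev's bound and π(x) = o(x)

-- d is the product of the primes in (m, s + m]; d ∣ (s + m) ! makes it coprime to the next prime.
primesInInterval-product : ∀ {N} m s → (∀ {q} → Prime q → m < q → q ≤ s + m → q ∣ N) →
  ∃[ d ] ∃[ c ] (primeCount (s + m) ≡ primeCount m + c × d ∣ N × d ∣ (s + m) ! × suc m ^ c ≤ d)
primesInInterval-product m zero    _   = 1 , 0 , sym (+-identityʳ _) , 1∣ _ , 1∣ _ , ≤-refl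
primesInInterval-product m (suc s) q∣N
  with primesInInterval-product m s (λ pq m<q q≤s+m → q∣N pq m<q (m≤n⇒m≤1+n q≤s+m))
... | d , c , π≡ , d∣N , d∣! , bound with prime? (suc (s + m))
... | yes pq = suc (s + m) * d , suc c , trans (cong suc π≡) (sym (+-suc _ c))
             , coprime-∣⇒*-∣ (prime∤⇒coprime pq λ q∣d → prime∤! (s + m) pq ≤-refl (∣-trans q∣d d∣!))
                             (q∣N pq (s≤s (m≤n+m m s)) ≤-refl) d∣N
             , *-pres-∣ (∣-refl {suc (s + m)}) d∣!
             , *-mono-≤ (s≤s (m≤n+m m s)) bound
... | no _   = d , c , π≡ , d∣N , ∣n⇒∣m*n (suc (s + m)) d∣! , bound

chebyshev : ∀ m → ∃[ c ] (primeCount (m + m) ≡ primeCount m + c × suc m ^ c ≤ 2 ^ (m + m))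
chebyshev m with primesInInterval-product m m (prime∣centralBinomial m)
... | d , c , π≡ , d∣C , _ , bound = c , π≡ , (begin
  suc m ^ c        ≤⟨ bound ⟩
  d                ≤⟨ ∣⇒≤ {{centralBinomial≢0 m}} d∣C ⟩
  (m + m) C m      ≤⟨ nCk≤2^n (m + m) m ⟩
  2 ^ (m + m)      ∎)
  where open ≤-Reasoning

-- With c primes in (m, 2m], the hypotheses give M ≤ m / 2 and M * c ≤ m / 2.
primeCount-doubling : ∀ M m → 2 ^ (M * 4) ≤ suc m → M * 2 ≤ m →
  M * primeCount (suc (m + m)) ≤ m + M * primeCount m
primeCount-doubling M m 2^4M≤1+m 2M≤m with chebyshev m
... | c , π≡ , bound = begin
  M * primeCount (suc (m + m))     ≤⟨ *-monoʳ-≤ M (primeCount-suc≤ (m + m)) ⟩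
  M * suc (primeCount (m + m))     ≡⟨ cong (λ t → M * suc t) π≡ ⟩
  M * suc (primeCount m + c)       ≡⟨ *-suc M _ ⟩
  M + M * (primeCount m + c)       ≡⟨ cong (M +_) (*-distribˡ-+ M (primeCount m) c) ⟩
  M + (M * primeCount m + M * c)   ≡⟨ cong (M +_) (+-comm (M * primeCount m) (M * c)) ⟩
  M + (M * c + M * primeCount m)   ≡⟨ +-assoc M (M * c) _ ⟨
  M + M * c + M * primeCount m     ≤⟨ +-monoˡ-≤ _ M+Mc≤m ⟩
  m + M * primeCount m             ∎
  where
  open ≤-Reasoning
  4Mc≤2m : M * 4 * c ≤ m + m
  4Mc≤2m = ^-cancelˡ-≤ 2 ≤-refl (begin
    2 ^ (M * 4 * c)      ≡⟨ ^-*-assoc 2 (M * 4) c ⟨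
    (2 ^ (M * 4)) ^ c    ≤⟨ ^-monoˡ-≤ c 2^4M≤1+m ⟩
    suc m ^ c            ≤⟨ bound ⟩
    2 ^ (m + m)          ∎)
  M+Mc≤m : M + M * c ≤ m
  M+Mc≤m = *-cancelˡ-≤ 4 (begin
    4 * (M + M * c)      ≡⟨ lhs-identity M c ⟩
    M * 4 + M * 4 * c    ≤⟨ +-mono-≤ (≤-trans (≤-reflexive (*-distribˡ-+ M 2 2)) (+-mono-≤ 2M≤m 2M≤m)) 4Mc≤2m ⟩
    m + m + (m + m)      ≡⟨ rhs-identity m ⟩
    4 * m                ∎)
    where
    lhs-identity : ∀ M c → 4 * (M + M * c) ≡ M * 4 + M * 4 * c
    lhs-identity = solve-∀
    rhs-identity : ∀ m → m + m + (m + m) ≡ 4 * m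
    rhs-identity = solve-∀

⌊n/2⌋+⌊n/2⌋≤n : ∀ n → ⌊ n /2⌋ + ⌊ n /2⌋ ≤ n
⌊n/2⌋+⌊n/2⌋≤n n = begin
  ⌊ n /2⌋ + ⌊ n /2⌋  ≤⟨ +-monoʳ-≤ ⌊ n /2⌋ (⌊n/2⌋≤⌈n/2⌉ n) ⟩
  ⌊ n /2⌋ + ⌈ n /2⌉  ≡⟨ ⌊n/2⌋+⌈n/2⌉≡n n ⟩
  n                  ∎
  where open ≤-Reasoning

n≤1+⌊n/2⌋+⌊n/2⌋ : ∀ n → n ≤ suc (⌊ n /2⌋ + ⌊ n /2⌋)
n≤1+⌊n/2⌋+⌊n/2⌋ n = begin
  n                        ≡⟨ ⌊n/2⌋+⌈n/2⌉≡n n ⟨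
  ⌊ n /2⌋ + ⌈ n /2⌉        ≤⟨ +-monoʳ-≤ ⌊ n /2⌋ (⌊n/2⌋-mono (n≤1+n (suc n))) ⟩
  ⌊ n /2⌋ + suc ⌊ n /2⌋    ≡⟨ +-suc ⌊ n /2⌋ ⌊ n /2⌋ ⟩
  suc (⌊ n /2⌋ + ⌊ n /2⌋)  ∎
  where open ≤-Reasoning

primeCount-sublinear : ∀ M → ∃[ C ] ∀ x → M * primeCount x ≤ x + C
primeCount-sublinear M = M * (m₀ + m₀) , <-rec _ bound
  where
  -- Above m₀ the hypotheses of primeCount-doubling hold; below 2 m₀ the bound π x ≤ x suffices.
  m₀ : ℕ
  m₀ = 2 ^ (M * 4) + M * 2

  bound : ∀ x → (∀ {y} → y < x → M * primeCount y ≤ y + M * (m₀ + m₀)) →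
          M * primeCount x ≤ x + M * (m₀ + m₀)
  bound x ih with m₀ ≤? ⌊ x /2⌋
  ... | yes m₀≤h = begin
    M * primeCount x                  ≤⟨ *-monoʳ-≤ M (primeCount-mono-≤ (n≤1+⌊n/2⌋+⌊n/2⌋ x)) ⟩
    M * primeCount (suc (h + h))      ≤⟨ primeCount-doubling M h 2^4M≤1+h 2M≤h ⟩
    h + M * primeCount h              ≤⟨ +-monoʳ-≤ h (ih h<x) ⟩
    h + (h + M * (m₀ + m₀))           ≡⟨ +-assoc h h _ ⟨
    h + h + M * (m₀ + m₀)             ≤⟨ +-monoˡ-≤ _ (⌊n/2⌋+⌊n/2⌋≤n x) ⟩
    x + M * (m₀ + m₀)                 ∎
    where
    open ≤-Reasoning
    h = ⌊ x /2⌋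
    2^4M≤1+h : 2 ^ (M * 4) ≤ suc h
    2^4M≤1+h = m≤n⇒m≤1+n (≤-trans (m≤m+n _ _) m₀≤h)
    2M≤h : M * 2 ≤ h
    2M≤h = ≤-trans (m≤n+m _ _) m₀≤h
    h<x : h < x
    h<x = <-≤-trans (m<m+n h (≤-trans (≤-trans (m^n>0 2 (M * 4)) (m≤m+n _ _)) m₀≤h)) (⌊n/2⌋+⌊n/2⌋≤n x)
  ... | no h≱m₀ = begin
    M * primeCount x      ≤⟨ *-monoʳ-≤ M (primeCount≤ x) ⟩
    M * x                 ≤⟨ *-monoʳ-≤ M x≤2m₀ ⟩
    M * (m₀ + m₀)         ≤⟨ m≤n+m _ x ⟩
    x + M * (m₀ + m₀)     ∎
    where
    open ≤-Reasoning
    h<m₀ : ⌊ x /2⌋ < m₀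
    h<m₀ = ≰⇒> h≱m₀
    x≤2m₀ : x ≤ m₀ + m₀
    x≤2m₀ = ≤-trans (n≤1+⌊n/2⌋+⌊n/2⌋ x) (+-mono-≤ h<m₀ (<⇒≤ h<m₀))

-- Since π (p m) = m, the bound (M + 1) π x ≤ x + C at x = p m reads (M + 1) m ≤ p m + C.
nthPrime-superlinear : ∀ {p} → IsPrimeEnumeration p → ∀ M → ∃[ C ] ∀ m → C < m → M * m < p m
nthPrime-superlinear {p} enum M with primeCount-sublinear (suc M)
... | C , sublinear = C , λ m C<m → +-cancelˡ-< m (M * m) (p m) (begin-strict
  m + M * m                  ≡⟨ cong (suc M *_) (proj₂ (enum m (≤-trans (s≤s z≤n) C<m))) ⟨
  suc M * primeCount (p m)   ≤⟨ sublinear (p m) ⟩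
  p m + C                    <⟨ +-monoʳ-< (p m) C<m ⟩
  p m + m                    ≡⟨ +-comm (p m) m ⟩
  m + p m                    ∎)
  where open ≤-Reasoning

-- Sequences whose consecutive ratios tend to infinity

increasing⇒n≤f[n] : ∀ (f : ℕ → ℕ) → (∀ k → f k < f (suc k)) → ∀ n → n ≤ f n
increasing⇒n≤f[n] f f-inc zero    = z≤n
increasing⇒n≤f[n] f f-inc (suc n) = ≤-trans (s≤s (increasing⇒n≤f[n] f f-inc n)) (f-inc n)

module RatioDivergent (f : ℕ → ℕ) (f-inc : ∀ k → f k < f (suc k))
                      (f-ratio : ∀ M → ∃[ K ] ∀ k → K ≤ k → M * f k < f (suc k)) where

  f-mono-< : ∀ {i j} → i < j → f i < f j
  f-mono-< {i} {suc j} (s≤s i≤j) with m≤n⇒m<n∨m≡n i≤j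
  ... | inj₁ i<j  = <-trans (f-mono-< i<j) (f-inc j)
  ... | inj₂ refl = f-inc j

  f-mono-≤ : ∀ {i j} → i ≤ j → f i ≤ f j
  f-mono-≤ i≤j with m≤n⇒m<n∨m≡n i≤j
  ... | inj₁ i<j  = <⇒≤ (f-mono-< i<j)
  ... | inj₂ refl = ≤-refl

  f-cancel-< : ∀ {i j} → f i < f j → i < j
  f-cancel-< fi<fj = ≰⇒> λ j≤i → <⇒≱ fi<fj (f-mono-≤ j≤i)

  n≤f[n] : ∀ n → n ≤ f n
  n≤f[n] = increasing⇒n≤f[n] f f-inc

  ratio-gap : ∃[ D ] (0 < D × ∀ {i j} → f j < f i → suc D * f j ≤ D * f i)
  ratio-gap with f-ratio 2
  ... | K , doubles = D , 0<D , gap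
    where
    D = f (suc K)
    0<D : 0 < D
    0<D = ≤-trans (s≤s z≤n) (n≤f[n] (suc K))

    small-or-doubled : ∀ {i j} → f j < f i → f j ≤ D ⊎ f j + f j ≤ f i
    small-or-doubled {i} {j} fj<fi with K ≤? j
    ... | yes K≤j = inj₂ (≤-trans (≤-reflexive (cong (f j +_) (sym (+-identityʳ (f j)))))
                           (<⇒≤ (<-≤-trans (doubles j K≤j) (f-mono-≤ (f-cancel-< fj<fi)))))
    ... | no K≰j  = inj₁ (f-mono-≤ (m≤n⇒m≤1+n (<⇒≤ (≰⇒> K≰j))))

    gap : ∀ {i j} → f j < f i → suc D * f j ≤ D * f i
    gap {i} {j} fj<fi with small-or-doubled fj<fi
    ... | inj₁ fj≤D = begin
      f j + D * f j      ≤⟨ +-monoˡ-≤ _ fj≤D ⟩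
      D + D * f j        ≡⟨ *-suc D (f j) ⟨
      D * suc (f j)      ≤⟨ *-monoʳ-≤ D fj<fi ⟩
      D * f i            ∎
      where open ≤-Reasoning
    ... | inj₂ 2fj≤fi = begin
      f j + D * f j      ≤⟨ +-monoˡ-≤ _ (m≤n*m (f j) D {{>-nonZero 0<D}}) ⟩
      D * f j + D * f j  ≡⟨ *-distribˡ-+ D (f j) (f j) ⟨
      D * (f j + f j)    ≤⟨ *-monoʳ-≤ D 2fj≤fi ⟩
      D * f i            ∎
      where open ≤-Reasoning

  ratio-bounded⇒index-bounded : ∀ M → ∃[ N ] ∀ {i j} → j < i → f i ≤ M * f j → i < N
  ratio-bounded⇒index-bounded M with f-ratio M
  ... | K , grows = suc (M * f K) , bounded
    where
    bounded : ∀ {i j} → j < i → f i ≤ M * f j → i < suc (M * f K)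
    bounded {i} {j} j<i fi≤Mfj with K ≤? j
    ... | yes K≤j = contradiction (<-≤-trans (grows j K≤j) (f-mono-≤ j<i)) (≤⇒≯ fi≤Mfj)
    ... | no K≰j  = s≤s (≤-trans (n≤f[n] i) (≤-trans fi≤Mfj (*-monoʳ-≤ M (f-mono-≤ (<⇒≤ (≰⇒> K≰j))))))

  not-ratio-dense : ¬ (∀ x y u v → 0 < x → 0 < y → 0 < v → x * v < u * y →
                         ∃[ i ] ∃[ j ] (x * f j < f i * y × f i * v < u * f j))
  not-ratio-dense dense with ratio-gap
  ... | D , 0<D , gap
      with dense 1 1 (suc D) D (s≤s z≤n) (s≤s z≤n) 0<D
                 (subst₂ _<_ (sym (*-identityˡ D)) (sym (*-identityʳ (suc D))) (n<1+n D))
  ... | i , j , 1*fj<fi*1 , fi*D<[1+D]*fj =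
    <⇒≱ fi*D<[1+D]*fj (subst (suc D * f j ≤_) (*-comm D (f i)) (gap fj<fi))
    where
    fj<fi : f j < f i
    fj<fi = subst₂ _<_ (*-identityˡ (f j)) (*-identityʳ (f i)) 1*fj<fi*1

  ratios-in-interval-finite : ∀ x y u v → 0 < x → 0 < v →
    ∃[ K ] ∀ i j → x * f j ≤ f i * y → f i * v ≤ u * f j →
      ∃[ i′ ] ∃[ j′ ] (i′ < K × j′ < K × f i * f j′ ≡ f i′ * f j)
  ratios-in-interval-finite x y u v 0<x 0<v with ratio-bounded⇒index-bounded (u + y)
  ... | N , bounded = suc N , witnesses
    where
    witnesses : ∀ i j → x * f j ≤ f i * y → f i * v ≤ u * f j →
      ∃[ i′ ] ∃[ j′ ] (i′ < suc N × j′ < suc N × f i * f j′ ≡ f i′ * f j)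
    witnesses i j xfj≤yfi vfi≤ufj with <-cmp i j
    ... | tri≈ _ refl _ = 0 , 0 , s≤s z≤n , s≤s z≤n , *-comm (f i) (f 0)
    ... | tri> _ _ j<i = i , j , m<n⇒m<1+n i<N , m<n⇒m<1+n (<-trans j<i i<N) , refl
      where
      i<N : i < N
      i<N = bounded j<i (begin
        f i            ≤⟨ m≤m*n (f i) v {{>-nonZero 0<v}} ⟩
        f i * v        ≤⟨ vfi≤ufj ⟩
        u * f j        ≤⟨ *-monoˡ-≤ (f j) (m≤m+n u y) ⟩
        (u + y) * f j  ∎)
        where open ≤-Reasoning
    ... | tri< i<j _ _ = i , j , m<n⇒m<1+n (<-trans i<j j<N) , m<n⇒m<1+n j<N , refl
      where
      j<N : j < N
      j<N = bounded i<j (begin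
        f j            ≤⟨ m≤n*m (f j) x {{>-nonZero 0<x}} ⟩
        x * f j        ≤⟨ xfj≤yfi ⟩
        f i * y        ≡⟨ *-comm (f i) y ⟩
        y * f i        ≤⟨ *-monoˡ-≤ (f i) (m≤n+m y u) ⟩
        (u + y) * f i  ∎)
        where open ≤-Reasoning

-- Iterated primes

module PrimeIterates (p : ℕ → ℕ) (enum : IsPrimeEnumeration p) (n : ℕ) (1≤n : 1 ≤ n) where

  iterate-pos : ∀ k → 1 ≤ iterate p k n
  iterate-pos zero    = 1≤n
  iterate-pos (suc k) = ≤-trans (s≤s z≤n) (prime⇒2≤ (proj₁ (enum _ (iterate-pos k))))

  iterate-inc : ∀ k → iterate p k n < iterate p (suc k) n
  iterate-inc k = isNthPrime⇒< (enum _ (iterate-pos k))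

  iterate-ratio-divergent : ∀ M → ∃[ K ] ∀ k → K ≤ k → M * iterate p k n < iterate p (suc k) n
  iterate-ratio-divergent M with nthPrime-superlinear enum M
  ... | C , superlinear = suc C , λ k C<k →
    superlinear (iterate p k n) (<-≤-trans C<k (increasing⇒n≤f[n] (λ j → iterate p j n) iterate-inc k))

  shifted-ratio-divergent : ∀ M → ∃[ K ] ∀ k → K ≤ k → M * iterate p (suc k) n < iterate p (suc (suc k)) n
  shifted-ratio-divergent M with iterate-ratio-divergent M
  ... | K , divergent = K , λ k K≤k → divergent (suc k) (m≤n⇒m≤1+n K≤k)

corollary3 : (p : ℕ → ℕ) → IsPrimeEnumeration p → (n : ℕ) → 1 ≤ n →
    -- (1) P^T_n = { p^(k)_n : k ≥ 1 } is not (R)-dense: it is not the case that every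
    --     open interval (x/y, u/v) with 0 < x/y < u/v contains a ratio a/b, a, b ∈ P^T_n
    (¬ (∀ x y u v → 0 < x → 0 < y → 0 < v → x * v < u * y →
          ∃[ i ] ∃[ j ] ((x * iterate p (suc j) n < iterate p (suc i) n * y)
                        × (iterate p (suc i) n * v < u * iterate p (suc j) n))))
    -- (2) p^(k+1)_n / p^(k)_n → +∞ as k → ∞
    × (∀ M → ∃[ K ] ∀ k → K ≤ k → M * iterate p k n < iterate p (suc k) n)
    -- (3) R^d(P^T_n) ∩ (0,∞) = ∅: every closed interval [x/y, u/v] with 0 < x/y
    --     contains only finitely many values of R(P^T_n), i.e. all such ratios
    --     a_i / a_j equal some a_i' / a_j' with i', j' < K
    × (∀ x y u v → 0 < x → 0 < y → 0 < v →
          ∃[ K ] ∀ i j →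
            x * iterate p (suc j) n ≤ iterate p (suc i) n * y →
            iterate p (suc i) n * v ≤ u * iterate p (suc j) n →
            ∃[ i′ ] ∃[ j′ ] (i′ < K × j′ < K ×
              (iterate p (suc i) n * iterate p (suc j′) n
                ≡ iterate p (suc i′) n * iterate p (suc j) n)))
corollary3 p enum n 1≤n =
  not-ratio-dense ,
  iterate-ratio-divergent ,
  λ x y u v 0<x _ 0<v → ratios-in-interval-finite x y u v 0<x 0<v
  where
  open PrimeIterates p enum n 1≤n
  open RatioDivergent (λ k → iterate p (suc k) n) (λ k → iterate-inc (suc k)) shifted-ratio-divergent
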